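{- For every finite abelian group $\mathcal G$ there is a constant $s(\mathcal G)\leq|\mathcal G|^2$ such that the following holds: if $G$ is a finite simple graph and $\ell$ a $\mathcal G$-labeling of $G$ such that $(G,\ell)$ is not zero-avoiding, then there is a non-empty connected $A\subseteq V(G)$ with $|A|\leq s(\mathcal G)$ and $\ell(A)=0$.
   Context: A $\mathcal G$-labeling of $G$ is a map $\ell: V(G)\to\mathcal G$, extended by $\ell(A)=\sum_{x\in A}\ell(x)$. A set $A\subseteq V(G)$ is connected if $G[A]$ is connected. $(G,\ell)$ is zero-avoiding if $\ell(A)\neq0$ for every non-empty connected $A\subseteq V(G)$. -}

module Defs where

open import Level using (Level; _⊔_)
open import Data.Nat using (ℕ; zero; suc)
open import Data.Fin using (Fin; zero; suc)
open import Data.Fin.Subset using (Subset; _∈_)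
open import Data.Vec using ([]; _∷_)
open import Data.Bool using (Bool; true; false; if_then_else_)
open import Data.Product using (∃; _×_)
open import Relation.Binary.PropositionalEquality using (_≡_; setoid)
open import Relation.Nullary using (¬_)
open import Algebra.Bundles using (AbelianGroup)
open import Function.Bundles using (Bijection)

-- A finite abelian group: an abelian group together with a bijection
-- (w.r.t. the group's setoid equality) from Fin n; then |𝒢| = n.
IsFiniteOfOrder : ∀ {c ℓ} → AbelianGroup c ℓ → ℕ → Set (c ⊔ ℓ)
IsFiniteOfOrder 𝒢 n = Bijection (setoid (Fin n)) (AbelianGroup.setoid 𝒢)

record SimpleGraph (m : ℕ) : Set where
  field
    adj     : Fin m → Fin m → Bool
    symm    : ∀ x y → adj x y ≡ adj y x
    irrefl  : ∀ x → adj x x ≡ false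
open SimpleGraph public

data ReachIn {m : ℕ} (G : SimpleGraph m) (A : Subset m) : Fin m → Fin m → Set where
  here : ∀ {x} → x ∈ A → ReachIn G A x x
  step : ∀ {x y z} → ReachIn G A x y → adj G y z ≡ true → z ∈ A → ReachIn G A x z

Connected : ∀ {m} → SimpleGraph m → Subset m → Set
Connected G A = ∀ {x y} → x ∈ A → y ∈ A → ReachIn G A x y

NonEmpty : ∀ {m} → Subset m → Set
NonEmpty A = ∃ λ x → x ∈ A

labelSum : ∀ {c ℓ} (𝒢 : AbelianGroup c ℓ) {m : ℕ} →
           (Fin m → AbelianGroup.Carrier 𝒢) → Subset m → AbelianGroup.Carrier 𝒢
labelSum 𝒢 lab [] = AbelianGroup.ε 𝒢
labelSum 𝒢 lab (b ∷ A) =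
  AbelianGroup._∙_ 𝒢 (if b then lab zero else AbelianGroup.ε 𝒢)
                     (labelSum 𝒢 (λ i → lab (suc i)) A)

ZeroAvoiding : ∀ {c ℓ} (𝒢 : AbelianGroup c ℓ) {m : ℕ} →
               SimpleGraph m → (Fin m → AbelianGroup.Carrier 𝒢) → Set ℓ
ZeroAvoiding 𝒢 G lab = ∀ A → NonEmpty A → Connected G A →
  ¬ (AbelianGroup._≈_ 𝒢 (labelSum 𝒢 lab A) (AbelianGroup.ε 𝒢))

-- Let A be a connected zero-sum set that is minimal under inclusion, with a
-- breadth-first spanning tree of G[A] rooted at r, and let n = |𝒢|.  Any set B ⊊ A
-- that contains a vertex c and the tree parent of each of its other vertices is
-- connected, so it cannot have sum 0.  If a vertex y had depth ≥ n, the subtrees of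
-- its ancestors at depths 0, …, n would be nested and, by pigeonhole, two of them
-- would have equal sums; their difference is such a B.  If a level t ≥ 1 had n
-- vertices, a strictly decreasing chain of n + 1 sets of level-t vertices gives, again
-- by pigeonhole, two nested unions of subtrees with equal sums; removing their
-- difference from A leaves such a B containing r.  Hence A has depth < n and fewer
-- than n vertices on each level but the first, so |A| ≤ 1 + (n-1)² ≤ n².
-- Minimal sets thus have BFS radius < n, and restricting the search to sets of
-- bounded radius makes the existence of a small zero-sum set decidable, which is how a
-- witness is extracted from ¬ ZeroAvoiding.
module Submission where

open import Defs
open import Level using (Level)
open import Data.Nat using (ℕ; _≤_; _^_)
open import Data.Fin using (Fin)
open import Data.Fin.Subset using (Subset; ∣_∣)
open import Data.Product using (∃; _×_)
open import Relation.Nullary using (¬_)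
open import Algebra.Bundles using (AbelianGroup)

open import Data.Bool using (true; if_then_else_)
import Data.Bool as Bool
open import Data.Fin using (zero; suc; toℕ; _≟_)
import Data.Fin as Fin
open import Data.Fin.Properties using (toℕ<n; pigeonhole; any?; all?)
open import Data.Fin.Subset
  using (_∈_; _∉_; _⊆_; _⊂_; _∪_; _─_; _-_; ⁅_⁆; inside; outside)
open import Data.Fin.Subset.Induction using (⊂-wellFounded; Acc; acc)
open import Data.Fin.Subset.Properties
  using ( _∈?_; nonempty?; anySubset?; Empty-unique; ∣⊥∣≡0; ∣⁅x⁆∣≡1; p⊆q⇒∣p∣≤∣q∣
        ; ⊆-refl; ⊆-trans; ⊆-⊂-trans; drop-∷-⊆; x∈⁅x⁆; x∈⁅y⁆⇒x≡y; x∈p∪q⁺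
        ; p─⊥≡p; p─q⊆p; x∈p∧x∉q⇒x∈p─q; x∈p⇒p-x⊂p )
import Data.Nat as ℕ
open import Data.Nat using (zero; suc; _<_; _+_; _*_; _∸_; _≤?_; z≤n; s≤s; s≤s⁻¹)
open import Data.Nat.GeneralisedArithmetic using (iterate)
open import Data.Nat.Properties
  using ( ≤-refl; ≤-reflexive; ≤-trans; ≤-antisym; <⇒≤; <⇒≱; ≰⇒>; 1+n≰n; n≤0⇒n≡0
        ; n≤1+n; n<1+n; m≤n⇒m≤1+n; m≤n⇒m<n∨m≡n; m≤n+m; suc-injective
        ; +-comm; +-suc; +-mono-≤; +-monoʳ-≤; *-monoʳ-≤; *-identityʳ
        ; m∸n≤m; m∸[m∸n]≡n; n∸n≡0; +-∸-assoc; m∸n+n≡m; module ≤-Reasoning )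
open import Data.Product using (_,_; proj₁; proj₂; ∃₂)
open import Data.Sum using (_⊎_; inj₁; inj₂)
open import Data.Vec using (_∷_; []; tabulate; here; there)
open import Data.Vec.Properties using (lookup∘tabulate; lookup⇒[]=; []=⇒lookup)
open import Function using (_∘_; id)
open import Function.Bundles using (Bijection; Surjection)
open import Relation.Binary using (Setoid)
import Relation.Binary as B
open import Relation.Binary.PropositionalEquality as ≡
  using (_≡_; _≢_; refl; cong; subst; subst₂)
open import Relation.Nullary
  using (contradiction; Dec; yes; no; does; _×-dec_; _⊎-dec_; _→-dec_)
open import Relation.Nullary.Decidable using (dec-true)
open import Relation.Unary using (Pred; Decidable)

module _ {m : ℕ} {p} {P : Pred (Fin m) p} where

  -- Opaque, so that P? can be recovered from ⟦ P? ⟧ by unification.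
  opaque
    ⟦_⟧ : Decidable P → Subset m
    ⟦ P? ⟧ = tabulate (does ∘ P?)

  opaque
    unfolding ⟦_⟧

    ∈⟦⟧⁺ : (P? : Decidable P) → ∀ {x} → P x → x ∈ ⟦ P? ⟧
    ∈⟦⟧⁺ P? {x} px = lookup⇒[]= x _ (≡.trans (lookup∘tabulate (does ∘ P?) x) (dec-true (P? x) px))

    ∈⟦⟧⁻ : (P? : Decidable P) → ∀ {x} → x ∈ ⟦ P? ⟧ → P x
    ∈⟦⟧⁻ P? {x} x∈ with P? x | ≡.trans (≡.sym (lookup∘tabulate (does ∘ P?) x)) ([]=⇒lookup x∈)
    ... | yes px | _ = px
    ... | no _   | ()

∣p∪q∣≤∣p∣+∣q∣ : ∀ {m} (p q : Subset m) → ∣ p ∪ q ∣ ≤ ∣ p ∣ + ∣ q ∣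
∣p∪q∣≤∣p∣+∣q∣ []            []            = z≤n
∣p∪q∣≤∣p∣+∣q∣ (inside  ∷ p) (inside  ∷ q) =
  s≤s (≤-trans (∣p∪q∣≤∣p∣+∣q∣ p q) (+-monoʳ-≤ ∣ p ∣ (n≤1+n ∣ q ∣)))
∣p∪q∣≤∣p∣+∣q∣ (inside  ∷ p) (outside ∷ q) = s≤s (∣p∪q∣≤∣p∣+∣q∣ p q)
∣p∪q∣≤∣p∣+∣q∣ (outside ∷ p) (inside  ∷ q) =
  subst (suc ∣ p ∪ q ∣ ≤_) (≡.sym (+-suc ∣ p ∣ ∣ q ∣)) (s≤s (∣p∪q∣≤∣p∣+∣q∣ p q))
∣p∪q∣≤∣p∣+∣q∣ (outside ∷ p) (outside ∷ q) = ∣p∪q∣≤∣p∣+∣q∣ p q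

x∈p⇒∣p∣≡1+∣p-x∣ : ∀ {m} {p : Subset m} {x} → x ∈ p → ∣ p ∣ ≡ suc ∣ p - x ∣
x∈p⇒∣p∣≡1+∣p-x∣ {p = inside ∷ p} here = cong (suc ∘ ∣_∣) (≡.sym (p─⊥≡p p))
x∈p⇒∣p∣≡1+∣p-x∣ {p = inside  ∷ p} (there x∈p) = cong suc (x∈p⇒∣p∣≡1+∣p-x∣ x∈p)
x∈p⇒∣p∣≡1+∣p-x∣ {p = outside ∷ p} (there x∈p) = x∈p⇒∣p∣≡1+∣p-x∣ x∈p

x∈p─q⇒x∉q : ∀ {m} (p q : Subset m) {x} → x ∈ p ─ q → x ∉ q
x∈p─q⇒x∉q (_ ∷ p) (inside ∷ q) () here
x∈p─q⇒x∉q (_ ∷ p) (_      ∷ q) (there x∈p─q) (there x∈q) = x∈p─q⇒x∉q p q x∈p─q x∈q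

⊂-chain : ∀ {m} k (X : Subset m) → k ≤ ∣ X ∣ →
          ∃ λ (C : Fin (suc k) → Subset m) → (∀ i → C i ⊆ X) × (∀ {i j} → i Fin.< j → C j ⊂ C i)
⊂-chain zero X _ = (λ _ → X) , (λ _ → id) , λ { {zero} {zero} () }
⊂-chain {m} (suc k) X k<∣X∣ with nonempty? X
... | no ∅ with () ← subst (suc k ≤_) (≡.trans (cong ∣_∣ (Empty-unique ∅)) (∣⊥∣≡0 m)) k<∣X∣
... | yes (x , x∈X)
  with C , C⊆ , C⊂ ← ⊂-chain k (X - x) (s≤s⁻¹ (subst (suc k ≤_) (x∈p⇒∣p∣≡1+∣p-x∣ x∈X) k<∣X∣))
  = C′ , C′⊆ , C′⊂
  where
  C′ : Fin (suc (suc k)) → Subset _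
  C′ zero    = X
  C′ (suc i) = C i
  C′⊆ : ∀ i → C′ i ⊆ X
  C′⊆ zero    = id
  C′⊆ (suc i) = ⊆-trans (C⊆ i) (p─q⊆p X ⁅ x ⁆)
  C′⊂ : ∀ {i j} → i Fin.< j → C′ j ⊂ C′ i
  C′⊂ {zero}  {suc j} _   = ⊆-⊂-trans (C⊆ j) (x∈p⇒p-x⊂p x∈X)
  C′⊂ {suc i} {suc j} i<j = C⊂ (s≤s⁻¹ i<j)

-- The least k ≤ N with P k, or N if there is none.
least : ∀ {p} {P : Pred ℕ p} → Decidable P → ℕ → ℕ
least P? zero    = 0
least P? (suc N) = if does (P? 0) then 0 else suc (least (P? ∘ suc) N)

least-sound : ∀ {p} {P : Pred ℕ p} (P? : Decidable P) N → P N → P (least P? N)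
least-sound P? zero    pN = pN
least-sound P? (suc N) pN with P? 0
... | yes p0 = p0
... | no _   = least-sound (P? ∘ suc) N pN

least-minimal : ∀ {p} {P : Pred ℕ p} (P? : Decidable P) N {j} → P j → least P? N ≤ j
least-minimal P? zero    _ = z≤n
least-minimal P? (suc N) {j} pj with P? 0 | j
... | yes _  | _     = z≤n
... | no ¬p0 | zero  = contradiction pj ¬p0
... | no _   | suc j = s≤s (least-minimal (P? ∘ suc) N pj)

module _ {c ℓ} {S : Setoid c ℓ} {n : ℕ} (bij : Bijection (≡.setoid (Fin n)) S) where
  open Setoid S
  open Bijection bij using (to; to⁻; injective; surjection) renaming (cong to to-cong)
  open Surjection surjection using (to∘to⁻)

  private
    to⁻-≡⇒≈ : ∀ {x y} → to⁻ x ≡ to⁻ y → x ≈ y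
    to⁻-≡⇒≈ {x} {y} e = trans (sym (to∘to⁻ x)) (trans (to-cong e) (to∘to⁻ y))

  ≈-dec : B.Decidable _≈_
  ≈-dec x y with to⁻ x ≟ to⁻ y
  ... | yes e = yes (to⁻-≡⇒≈ e)
  ... | no ne = no λ x≈y → ne (injective (trans (to∘to⁻ x) (trans x≈y (sym (to∘to⁻ y)))))

  pigeonhole-≈ : (f : Fin (suc n) → Carrier) → ∃₂ λ i j → i Fin.< j × f i ≈ f j
  pigeonhole-≈ f with i , j , i<j , e ← pigeonhole (n<1+n n) (to⁻ ∘ f) = i , j , i<j , to⁻-≡⇒≈ e

module _ {c ℓ} (𝒢 : AbelianGroup c ℓ) where
  open AbelianGroup 𝒢
  open import Relation.Binary.Reasoning.Setoid setoid
  open import Algebra.Properties.CommutativeSemigroup commutativeSemigroup using (interchange)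
  open import Algebra.Properties.AbelianGroup 𝒢 using (identityʳ-unique)

  private
    ∙-cong-interchange : ∀ {a b c x y z} → a ≈ b ∙ c → x ≈ y ∙ z → a ∙ x ≈ (b ∙ y) ∙ (c ∙ z)
    ∙-cong-interchange {b = b} {c} {y = y} {z} a≈ x≈ = begin
      _                 ≈⟨ ∙-cong a≈ x≈ ⟩
      (b ∙ c) ∙ (y ∙ z) ≈⟨ interchange b c y z ⟩
      (b ∙ y) ∙ (c ∙ z) ∎

  labelSum-─ : ∀ {m} (lab : Fin m → Carrier) {p q : Subset m} → q ⊆ p →
               labelSum 𝒢 lab p ≈ labelSum 𝒢 lab q ∙ labelSum 𝒢 lab (p ─ q)
  labelSum-─ lab {[]}          {[]}          _   = sym (identityˡ ε)
  labelSum-─ lab {s ∷ p}       {outside ∷ q} q⊆p =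
    ∙-cong-interchange (sym (identityˡ _)) (labelSum-─ (lab ∘ suc) (drop-∷-⊆ q⊆p))
  labelSum-─ lab {inside ∷ p}  {inside ∷ q}  q⊆p =
    ∙-cong-interchange (sym (identityʳ _)) (labelSum-─ (lab ∘ suc) (drop-∷-⊆ q⊆p))
  labelSum-─ lab {outside ∷ p} {inside ∷ q}  q⊆p with () ← q⊆p here

  labelSum-─≈ε : ∀ {m} (lab : Fin m → Carrier) {p q : Subset m} → q ⊆ p →
                 labelSum 𝒢 lab q ≈ labelSum 𝒢 lab p → labelSum 𝒢 lab (p ─ q) ≈ ε
  labelSum-─≈ε lab q⊆p q≈p =
    identityʳ-unique _ _ (trans (sym (labelSum-─ lab q⊆p)) (sym q≈p))

  chain-zero-difference : ∀ {n m} → IsFiniteOfOrder 𝒢 n → (lab : Fin m → Carrier) →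
    (C : Fin (suc n) → Subset m) → (∀ {i j} → i Fin.< j → C j ⊆ C i) →
    ∃₂ λ i j → i Fin.< j × labelSum 𝒢 lab (C i ─ C j) ≈ ε
  chain-zero-difference fin lab C C↓
    with i , j , i<j , e ← pigeonhole-≈ fin (labelSum 𝒢 lab ∘ C)
    = i , j , i<j , labelSum-─≈ε lab (C↓ i<j) (sym e)

module _ {m} (G : SimpleGraph m) where

  reach-end : ∀ {A x y} → ReachIn G A x y → y ∈ A
  reach-end (here x∈A)     = x∈A
  reach-end (step _ _ z∈A) = z∈A

  reach-trans : ∀ {A x y z} → ReachIn G A x y → ReachIn G A y z → ReachIn G A x z
  reach-trans r (here _)         = r
  reach-trans r (step q uv v∈A) = step (reach-trans r q) uv v∈A

  reach-sym : ∀ {A x y} → ReachIn G A x y → ReachIn G A y x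
  reach-sym (here x∈A) = here x∈A
  reach-sym (step {y = u} {z = v} r uv v∈A) =
    reach-trans (step (here v∈A) (≡.trans (symm G v u) uv) (reach-end r)) (reach-sym r)

  ParentStep : Subset m → (Fin m → ℕ) → Fin m → Fin m → Set
  ParentStep B depth u w = u ∈ B × depth w ≡ suc (depth u) × adj G u w ≡ true

  ParentClosed : Subset m → Fin m → (Fin m → Fin m) → (Fin m → ℕ) → Set
  ParentClosed B c parent depth = ∀ {w} → w ∈ B → w ≢ c → ParentStep B depth (parent w) w

  parentClosed⇒connected : ∀ {B c parent depth} → c ∈ B → ParentClosed B c parent depth →
                           Connected G B
  parentClosed⇒connected {B} {c} {parent} {depth} c∈B closed x∈B y∈B =
    reach-trans (reach-sym (from-c _ refl x∈B)) (from-c _ refl y∈B)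
    where
    from-c : ∀ d {w} → depth w ≡ d → w ∈ B → ReachIn G B c w
    from-c d {w} d≡ w∈B with w ≟ c
    ... | yes refl = here c∈B
    ... | no w≢c with closed w∈B w≢c
    from-c zero    d≡ w∈B | no w≢c | _ , d≡′ , _ with () ← ≡.trans (≡.sym d≡) d≡′
    from-c (suc d) d≡ w∈B | no w≢c | p∈B , d≡′ , pw =
      step (from-c d (suc-injective (≡.trans (≡.sym d≡′) d≡)) p∈B) pw w∈B

module Distance {m} (G : SimpleGraph m) (A : Subset m) (r : Fin m) where

  Within : ℕ → Fin m → Set
  Within zero    y = y ≡ r
  Within (suc k) y = Within k y ⊎ (y ∈ A × ∃ λ u → Within k u × adj G u y ≡ true)

  within? : ∀ k → Decidable (Within k)
  within? zero    y = y ≟ r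
  within? (suc k) y =
    within? k y ⊎-dec ((y ∈? A) ×-dec any? λ u → within? k u ×-dec (adj G u y Bool.≟ true))

  within⇒reach : r ∈ A → ∀ {k y} → Within k y → ReachIn G A r y
  within⇒reach r∈A {zero}  refl                      = here r∈A
  within⇒reach r∈A {suc k} (inj₁ w)                  = within⇒reach r∈A w
  within⇒reach r∈A {suc k} (inj₂ (y∈A , u , w , uy)) = step (within⇒reach r∈A w) uy y∈A

  reach⇒within : ∀ {y} → ReachIn G A r y → ∃ λ k → Within k y
  reach⇒within (here _) = 0 , refl
  reach⇒within (step {y = u} q uy y∈A) with k , w ← reach⇒within q = suc k , inj₂ (y∈A , u , w , uy)

RadiusAtMost : ∀ {m} → SimpleGraph m → ℕ → Subset m → Set
RadiusAtMost G k A = ∃ λ r → r ∈ A × ∀ y → y ∈ A → Distance.Within G A r k y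

radiusAtMost? : ∀ {m} (G : SimpleGraph m) k → Decidable (RadiusAtMost G k)
radiusAtMost? G k A = any? λ r → (r ∈? A) ×-dec all? λ y → (y ∈? A) →-dec Distance.within? G A r k y

radius⇒connected : ∀ {m} {G : SimpleGraph m} {k A} → RadiusAtMost G k A → Connected G A
radius⇒connected {G = G} {A = A} (r , r∈A , within) x∈A y∈A =
  reach-trans G (reach-sym G (from-r x∈A)) (from-r y∈A)
  where from-r = λ {y} y∈A → Distance.within⇒reach G A r r∈A (within y y∈A)

record RootedTree {m} (G : SimpleGraph m) (A : Subset m) : Set where
  field
    root         : Fin m
    parent       : Fin m → Fin m
    depth        : Fin m → ℕ
    root∈A       : root ∈ A
    depth-root   : depth root ≡ 0
    parentClosed : ParentClosed G A root parent depth

  parent∈A : ∀ {w} → w ∈ A → w ≢ root → parent w ∈ A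
  parent∈A w∈A w≢r = proj₁ (parentClosed w∈A w≢r)

  depth-parent : ∀ {w} → w ∈ A → w ≢ root → depth w ≡ suc (depth (parent w))
  depth-parent w∈A w≢r = proj₁ (proj₂ (parentClosed w∈A w≢r))

  depth≡0⇒root : ∀ {w} → w ∈ A → depth w ≡ 0 → w ≡ root
  depth≡0⇒root {w} w∈A d≡0 with w ≟ root
  ... | yes w≡r = w≡r
  ... | no w≢r with () ← ≡.trans (≡.sym d≡0) (depth-parent w∈A w≢r)

  depth>0⇒≢root : ∀ {w} → 0 < depth w → w ≢ root
  depth>0⇒≢root 0<d refl with () ← subst (0 <_) depth-root 0<d

  depth≤⇒within : ∀ k {y} → y ∈ A → depth y ≤ k → Distance.Within G A root k y
  depth≤⇒within zero    y∈A d≤0 = depth≡0⇒root y∈A (n≤0⇒n≡0 d≤0)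
  depth≤⇒within (suc k) {y} y∈A d≤ with y ≟ root
  ... | yes refl = inj₁ (depth≤⇒within k root∈A (subst (_≤ k) (≡.sym depth-root) z≤n))
  ... | no y≢r with p∈A , d≡ , py ← parentClosed y∈A y≢r =
    inj₂ (y∈A , parent y , depth≤⇒within k p∈A (s≤s⁻¹ (subst (_≤ suc k) d≡ d≤)) , py)

  radiusAtMost : ∀ {k} → (∀ {y} → y ∈ A → depth y ≤ k) → RadiusAtMost G k A
  radiusAtMost {k} d≤k = root , root∈A , λ y y∈A → depth≤⇒within k y∈A (d≤k y∈A)

module Layers {m} {G : SimpleGraph m} {A : Subset m} (T : RootedTree G A) where
  open RootedTree T

  private
    atDepth? : ∀ t → Decidable (λ w → w ∈ A × depth w ≡ t)
    atDepth? t w = (w ∈? A) ×-dec (depth w ℕ.≟ t)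

    withinDepth? : ∀ t → Decidable (λ w → w ∈ A × depth w ≤ t)
    withinDepth? t w = (w ∈? A) ×-dec (depth w ≤? t)

  level : ℕ → Subset m
  level t = ⟦ atDepth? t ⟧

  ball : ℕ → Subset m
  ball t = ⟦ withinDepth? t ⟧

  ∈-level⁻ : ∀ {t w} → w ∈ level t → w ∈ A × depth w ≡ t
  ∈-level⁻ {t} = ∈⟦⟧⁻ (atDepth? t)

  ∣ball∣≤ : ∀ {k} → (∀ t → ∣ level (suc t) ∣ ≤ k) → ∀ t → ∣ ball t ∣ ≤ suc (t * k)
  ∣ball∣≤ {k} ∣level∣≤k zero = ≤-trans (p⊆q⇒∣p∣≤∣q∣ ball0⊆root) (≤-reflexive (∣⁅x⁆∣≡1 root))
    where
    ball0⊆root : ball 0 ⊆ ⁅ root ⁆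
    ball0⊆root w∈ with w∈A , d≤0 ← ∈⟦⟧⁻ (withinDepth? 0) w∈ =
      subst (_∈ ⁅ root ⁆) (≡.sym (depth≡0⇒root w∈A (n≤0⇒n≡0 d≤0))) (x∈⁅x⁆ root)
  ∣ball∣≤ {k} ∣level∣≤k (suc t) = begin
    ∣ ball (suc t) ∣               ≤⟨ p⊆q⇒∣p∣≤∣q∣ ball-suc⊆ ⟩
    ∣ ball t ∪ level (suc t) ∣     ≤⟨ ∣p∪q∣≤∣p∣+∣q∣ (ball t) (level (suc t)) ⟩
    ∣ ball t ∣ + ∣ level (suc t) ∣ ≤⟨ +-mono-≤ (∣ball∣≤ ∣level∣≤k t) (∣level∣≤k t) ⟩
    suc (t * k) + k                ≡⟨ cong suc (+-comm (t * k) k) ⟩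
    suc (suc t * k)                ∎
    where
    open ≤-Reasoning
    ball-suc⊆ : ball (suc t) ⊆ ball t ∪ level (suc t)
    ball-suc⊆ w∈ with w∈A , d≤ ← ∈⟦⟧⁻ (withinDepth? (suc t)) w∈ with m≤n⇒m<n∨m≡n d≤
    ... | inj₁ d< = x∈p∪q⁺ (inj₁ (∈⟦⟧⁺ (withinDepth? t) (w∈A , s≤s⁻¹ d<)))
    ... | inj₂ d≡ = x∈p∪q⁺ (inj₂ (∈⟦⟧⁺ (atDepth? (suc t)) (w∈A , d≡)))

  ∣A∣≤ : ∀ {k} → (∀ {y} → y ∈ A → depth y ≤ k) → (∀ t → ∣ level (suc t) ∣ ≤ k) →
         ∣ A ∣ ≤ suc (k * k)
  ∣A∣≤ {k} d≤k ∣level∣≤k =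
    ≤-trans (p⊆q⇒∣p∣≤∣q∣ (λ y∈A → ∈⟦⟧⁺ (withinDepth? k) (y∈A , d≤k y∈A))) (∣ball∣≤ ∣level∣≤k k)

module Ancestry {m} {G : SimpleGraph m} {A : Subset m} (T : RootedTree G A) where
  open RootedTree T

  -- Only meaningful for t ≤ depth w: otherwise depth w ∸ t = 0 and this is w itself.
  ancestor : ℕ → Fin m → Fin m
  ancestor t w = iterate parent w (depth w ∸ t)

  private
    up : ℕ → Fin m → Fin m
    up k w = iterate parent w k

    up-+ : ∀ k l w → up (k + l) w ≡ up l (up k w)
    up-+ zero    l w = refl
    up-+ (suc k) l w = up-+ k l (parent w)

    up-∈A-depth : ∀ k {w} → w ∈ A → k ≤ depth w → up k w ∈ A × depth (up k w) ≡ depth w ∸ k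
    up-∈A-depth zero    w∈A _   = w∈A , refl
    up-∈A-depth (suc k) w∈A k<d
      with w≢r ← depth>0⇒≢root (≤-trans (s≤s z≤n) k<d)
      rewrite depth-parent w∈A w≢r = up-∈A-depth k (parent∈A w∈A w≢r) (s≤s⁻¹ k<d)

  ancestor-∈A : ∀ t {w} → w ∈ A → ancestor t w ∈ A
  ancestor-∈A t {w} w∈A = proj₁ (up-∈A-depth (depth w ∸ t) w∈A (m∸n≤m (depth w) t))

  depth-ancestor : ∀ {t w} → w ∈ A → t ≤ depth w → depth (ancestor t w) ≡ t
  depth-ancestor {t} {w} w∈A t≤d =
    ≡.trans (proj₂ (up-∈A-depth (depth w ∸ t) w∈A (m∸n≤m (depth w) t))) (m∸[m∸n]≡n t≤d)

  ancestor-self : ∀ w → ancestor (depth w) w ≡ w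
  ancestor-self w = cong (iterate parent w) (n∸n≡0 (depth w))

  ancestor-parent : ∀ {t w} → w ∈ A → w ≢ root → t ≤ depth (parent w) →
                    ancestor t (parent w) ≡ ancestor t w
  ancestor-parent {t} {w} w∈A w≢r t≤dp = begin
    up (depth (parent w) ∸ t) (parent w) ≡⟨⟩
    up (suc (depth (parent w) ∸ t)) w    ≡⟨ cong (λ k → up k w) (+-∸-assoc 1 t≤dp) ⟨
    up (suc (depth (parent w)) ∸ t) w    ≡⟨ cong (λ d → up (d ∸ t) w) (depth-parent w∈A w≢r) ⟨
    ancestor t w                         ∎
    where open ≡.≡-Reasoning

  ancestor-ancestor : ∀ {s t w} → w ∈ A → s ≤ t → t ≤ depth w →
                      ancestor s (ancestor t w) ≡ ancestor s w
  ancestor-ancestor {s} {t} {w} w∈A s≤t t≤d = begin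
    up (depth (ancestor t w) ∸ s) (ancestor t w)
      ≡⟨ cong (λ d → up (d ∸ s) (ancestor t w)) (depth-ancestor w∈A t≤d) ⟩
    up (t ∸ s) (up (depth w ∸ t) w)
      ≡⟨ up-+ (depth w ∸ t) (t ∸ s) w ⟨
    up (depth w ∸ t + (t ∸ s)) w
      ≡⟨ cong (λ k → up k w) (+-∸-assoc (depth w ∸ t) s≤t) ⟨
    up (depth w ∸ t + t ∸ s) w
      ≡⟨ cong (λ d → up (d ∸ s) w) (m∸n+n≡m t≤d) ⟩
    ancestor s w
      ∎
    where open ≡.≡-Reasoning

  private
    descendant? : ∀ t X → Decidable (λ w → w ∈ A × t ≤ depth w × ancestor t w ∈ X)
    descendant? t X w = (w ∈? A) ×-dec (t ≤? depth w) ×-dec (ancestor t w ∈? X)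

  descendants : ℕ → Subset m → Subset m
  descendants t X = ⟦ descendant? t X ⟧

  ∈-descendants⁺ : ∀ {t X w} → w ∈ A → t ≤ depth w → ancestor t w ∈ X → w ∈ descendants t X
  ∈-descendants⁺ {t} {X} w∈A t≤d a∈X = ∈⟦⟧⁺ (descendant? t X) (w∈A , t≤d , a∈X)

  ∈-descendants⁻ : ∀ {t X w} → w ∈ descendants t X → w ∈ A × t ≤ depth w × ancestor t w ∈ X
  ∈-descendants⁻ {t} {X} = ∈⟦⟧⁻ (descendant? t X)

  descendants⊆A : ∀ {t X} → descendants t X ⊆ A
  descendants⊆A = proj₁ ∘ ∈-descendants⁻

  descendants-mono : ∀ {t X Y} → X ⊆ Y → descendants t X ⊆ descendants t Y
  descendants-mono X⊆Y w∈ with w∈A , t≤d , a∈X ← ∈-descendants⁻ w∈ =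
    ∈-descendants⁺ w∈A t≤d (X⊆Y a∈X)

  self∈descendants : ∀ {X w} → w ∈ A → w ∈ X → w ∈ descendants (depth w) X
  self∈descendants {w = w} w∈A w∈X =
    ∈-descendants⁺ w∈A ≤-refl (subst (_∈ _) (≡.sym (ancestor-self w)) w∈X)

  self∈descendants⁻ : ∀ {X w} → w ∈ descendants (depth w) X → w ∈ X
  self∈descendants⁻ {X} {w} w∈ =
    subst (_∈ X) (ancestor-self w) (proj₂ (proj₂ (∈-descendants⁻ w∈)))

  root∉descendants : ∀ {t X} → root ∉ descendants (suc t) X
  root∉descendants r∈ with () ← subst (suc _ ≤_) depth-root (proj₁ (proj₂ (∈-descendants⁻ r∈)))

  descendants-parent⁺ : ∀ {t X w} → w ∈ A → w ≢ root → t ≤ depth (parent w) →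
                        w ∈ descendants t X → parent w ∈ descendants t X
  descendants-parent⁺ {X = X} w∈A w≢r t≤dp w∈ =
    ∈-descendants⁺ (parent∈A w∈A w≢r) t≤dp
      (subst (_∈ X) (≡.sym (ancestor-parent w∈A w≢r t≤dp)) (proj₂ (proj₂ (∈-descendants⁻ w∈))))

  UpwardClosedExcept : Subset m → Fin m → Set
  UpwardClosedExcept P c = ∀ {w} → w ∈ P → w ≢ c → w ≢ root × parent w ∈ P

  DownwardClosed : Subset m → Set
  DownwardClosed Q = ∀ {w} → w ∈ A → w ≢ root → parent w ∈ Q → w ∈ Q

  A-upwardClosed : UpwardClosedExcept A root
  A-upwardClosed w∈A w≢r = w≢r , parent∈A w∈A w≢r

  descendants-downwardClosed : ∀ {t X} → DownwardClosed (descendants t X)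
  descendants-downwardClosed {X = X} w∈A w≢r p∈ with _ , t≤dp , a∈X ← ∈-descendants⁻ p∈ =
    ∈-descendants⁺ w∈A (subst (_ ≤_) (≡.sym (depth-parent w∈A w≢r)) (m≤n⇒m≤1+n t≤dp))
      (subst (_∈ X) (ancestor-parent w∈A w≢r t≤dp) a∈X)

  descendants-─-downwardClosed : ∀ {t X Y} → DownwardClosed (descendants t X ─ descendants t Y)
  descendants-─-downwardClosed {t} {X} {Y} w∈A w≢r p∈ =
    x∈p∧x∉q⇒x∈p─q (descendants-downwardClosed w∈A w≢r p∈X)
      (x∈p─q⇒x∉q _ _ p∈ ∘ descendants-parent⁺ w∈A w≢r (proj₁ (proj₂ (∈-descendants⁻ p∈X))))
    where p∈X = p─q⊆p (descendants t X) (descendants t Y) p∈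

  ─-parentClosed : ∀ {P Q c} → P ⊆ A → UpwardClosedExcept P c → DownwardClosed Q →
                   ParentClosed G (P ─ Q) c parent depth
  ─-parentClosed {P} {Q} P⊆A up down w∈P─Q w≢c
    with w∈P ← p─q⊆p P Q w∈P─Q | w≢r , p∈P ← up (p─q⊆p P Q w∈P─Q) w≢c
    = x∈p∧x∉q⇒x∈p─q p∈P (x∈p─q⇒x∉q P Q w∈P─Q ∘ down w∈A w≢r) , proj₂ (parentClosed w∈A w≢r)
    where w∈A = P⊆A w∈P

  subtree : Fin m → Subset m
  subtree u = descendants (depth u) ⁅ u ⁆

  self∈subtree : ∀ {u} → u ∈ A → u ∈ subtree u
  self∈subtree {u} u∈A = self∈descendants u∈A (x∈⁅x⁆ u)

  depth<⇒∉subtree : ∀ {u v} → depth v < depth u → v ∉ subtree u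
  depth<⇒∉subtree dv<du v∈ = <⇒≱ dv<du (proj₁ (proj₂ (∈-descendants⁻ v∈)))

  subtree-upwardClosed : ∀ u → UpwardClosedExcept (subtree u) u
  subtree-upwardClosed u {w} w∈ w≢u with w∈A , du≤dw , _ ← ∈-descendants⁻ w∈
    with m≤n⇒m<n∨m≡n du≤dw
  ... | inj₂ du≡dw = contradiction
    (x∈⁅y⁆⇒x≡y u (self∈descendants⁻ (subst (λ d → w ∈ descendants d ⁅ u ⁆) du≡dw w∈))) w≢u
  ... | inj₁ du<dw = w≢r , descendants-parent⁺ w∈A w≢r du≤dp w∈
    where
    w≢r  = depth>0⇒≢root (≤-trans (s≤s z≤n) du<dw)
    du≤dp = s≤s⁻¹ (subst (depth u <_) (depth-parent w∈A w≢r) du<dw)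

  subtree-ancestor : ∀ {s u} → u ∈ A → s ≤ depth u → subtree u ⊆ subtree (ancestor s u)
  subtree-ancestor {s} {u} u∈A s≤du {w} w∈ with w∈A , du≤dw , a∈ ← ∈-descendants⁻ w∈ =
    ∈-descendants⁺ w∈A (subst (_≤ depth w) (≡.sym (depth-ancestor u∈A s≤du)) (≤-trans s≤du du≤dw))
      (subst (_∈ ⁅ ancestor s u ⁆) ancestor≡ (x∈⁅x⁆ (ancestor s u)))
    where
    ancestor≡ : ancestor s u ≡ ancestor (depth (ancestor s u)) w
    ancestor≡ = begin
      ancestor s u                      ≡⟨ cong (ancestor s) (x∈⁅y⁆⇒x≡y u a∈) ⟨
      ancestor s (ancestor (depth u) w) ≡⟨ ancestor-ancestor w∈A s≤du du≤dw ⟩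
      ancestor s w                      ≡⟨ cong (λ d → ancestor d w) (depth-ancestor u∈A s≤du) ⟨
      ancestor (depth (ancestor s u)) w ∎
      where open ≡.≡-Reasoning

module BreadthFirst {m} (G : SimpleGraph m) {A : Subset m} {r : Fin m}
                    (r∈A : r ∈ A) (connected : Connected G A) where
  open Distance G A r

  private
    bound : Fin m → ℕ
    bound y with y ∈? A
    ... | yes y∈A = proj₁ (reach⇒within (connected r∈A y∈A))
    ... | no _    = 0

    within-bound : ∀ {y} → y ∈ A → Within (bound y) y
    within-bound {y} y∈A with y ∈? A
    ... | yes y∈A′ = proj₂ (reach⇒within (connected r∈A y∈A′))
    ... | no y∉A   = contradiction y∈A y∉A

  depth : Fin m → ℕ
  depth y = least (λ k → within? k y) (bound y)

  within-depth : ∀ {y} → y ∈ A → Within (depth y) y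
  within-depth {y} y∈A = least-sound (λ k → within? k y) (bound y) (within-bound y∈A)

  depth-minimal : ∀ {k y} → Within k y → depth y ≤ k
  depth-minimal {y = y} = least-minimal (λ k → within? k y) (bound y)

  private
    parentStep? : ∀ y → Decidable (λ u → ParentStep G A depth u y)
    parentStep? y u = (u ∈? A) ×-dec (depth y ℕ.≟ suc (depth u)) ×-dec (adj G u y Bool.≟ true)

    pick : ∀ {y} → Dec (∃ λ u → ParentStep G A depth u y) → Fin m
    pick {y} (yes (u , _)) = u
    pick {y} (no _)        = y

    pick-step : ∀ {y} (d : Dec (∃ λ u → ParentStep G A depth u y)) →
                ∃ (λ u → ParentStep G A depth u y) → ParentStep G A depth (pick d) y
    pick-step (yes (_ , s)) _ = s
    pick-step (no ∄)        ∃ = contradiction ∃ ∄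

  -- Defaults to y where no parent step exists, in particular at the root.
  parent : Fin m → Fin m
  parent y = pick (any? (parentStep? y))

  parentStep-exists : ∀ {y} → y ∈ A → y ≢ r → ∃ λ u → ParentStep G A depth u y
  parentStep-exists {y} y∈A y≢r = from (depth y) refl (within-depth y∈A)
    where
    from : ∀ d → depth y ≡ d → Within d y → ∃ λ u → ParentStep G A depth u y
    from zero    _  y≡r      = contradiction y≡r y≢r
    from (suc k) d≡ (inj₁ w) = contradiction (subst (_≤ k) d≡ (depth-minimal w)) 1+n≰n
    from (suc k) d≡ (inj₂ (_ , u , w , uy)) = u , u∈A , ≤-antisym upper lower , uy
      where
      u∈A = reach-end G (within⇒reach r∈A w)
      upper : depth y ≤ suc (depth u)
      upper = depth-minimal (inj₂ (y∈A , u , within-depth u∈A , uy))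
      lower : suc (depth u) ≤ depth y
      lower = subst (suc (depth u) ≤_) (≡.sym d≡) (s≤s (depth-minimal w))

  tree : RootedTree G A
  tree = record
    { root         = r
    ; parent       = parent
    ; depth        = depth
    ; root∈A       = r∈A
    ; depth-root   = n≤0⇒n≡0 (depth-minimal {0} refl)
    ; parentClosed = λ {y} y∈A y≢r → pick-step (any? (parentStep? y)) (parentStep-exists y∈A y≢r)
    }

module MinimalZeroSum {c ℓ} (𝒢 : AbelianGroup c ℓ) {n} (fin : IsFiniteOfOrder 𝒢 n)
  {m} {G : SimpleGraph m} (lab : Fin m → AbelianGroup.Carrier 𝒢) {A : Subset m}
  (T : RootedTree G A)
  (zeroSum : AbelianGroup._≈_ 𝒢 (labelSum 𝒢 lab A) (AbelianGroup.ε 𝒢))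
  (minimal : ∀ B → B ⊂ A → NonEmpty B → Connected G B →
             ¬ AbelianGroup._≈_ 𝒢 (labelSum 𝒢 lab B) (AbelianGroup.ε 𝒢)) where

  open AbelianGroup 𝒢 using (_≈_; ε; sym; trans)
  open RootedTree T
  open Ancestry T
  open Layers T using (level; ∈-level⁻)

  proper-parentClosed-≉ε : ∀ {B c x} → B ⊆ A → x ∈ A → x ∉ B → c ∈ B →
                           ParentClosed G B c parent depth → ¬ labelSum 𝒢 lab B ≈ ε
  proper-parentClosed-≉ε {B} B⊆A x∈A x∉B c∈B closed =
    minimal B (B⊆A , _ , x∈A , x∉B) (_ , c∈B) (parentClosed⇒connected G c∈B closed)

  n≰depth : ∀ {y} → y ∈ A → ¬ n ≤ depth y
  n≰depth {y} y∈A n≤d = absurd (chain-zero-difference 𝒢 fin lab C C↓)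
    where
    i≤d : ∀ i → toℕ i ≤ depth y
    i≤d i = ≤-trans (s≤s⁻¹ (toℕ<n i)) n≤d
    a : Fin (suc n) → Fin m
    a i = ancestor (toℕ i) y
    a∈A : ∀ i → a i ∈ A
    a∈A i = ancestor-∈A (toℕ i) y∈A
    depth-a : ∀ i → depth (a i) ≡ toℕ i
    depth-a i = depth-ancestor y∈A (i≤d i)
    C : Fin (suc n) → Subset m
    C i = subtree (a i)
    C↓ : ∀ {i j} → i Fin.< j → C j ⊆ C i
    C↓ {i} {j} i<j = subst (λ v → C j ⊆ subtree v) (ancestor-ancestor y∈A (<⇒≤ i<j) (i≤d j))
      (subtree-ancestor (a∈A j) (subst (toℕ i ≤_) (≡.sym (depth-a j)) (<⇒≤ i<j)))
    absurd : ¬ ∃₂ λ i j → i Fin.< j × labelSum 𝒢 lab (C i ─ C j) ≈ ε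
    absurd (i , j , i<j , C≈ε) =
      proper-parentClosed-≉ε (descendants⊆A ∘ p─q⊆p (C i) (C j)) (a∈A j)
        (λ aj∈ → x∈p─q⇒x∉q (C i) (C j) aj∈ (self∈subtree (a∈A j)))
        (x∈p∧x∉q⇒x∈p─q (self∈subtree (a∈A i))
          (depth<⇒∉subtree (subst₂ ℕ._<_ (≡.sym (depth-a i)) (≡.sym (depth-a j)) i<j)))
        (─-parentClosed descendants⊆A (subtree-upwardClosed (a i))
          descendants-downwardClosed)
        C≈ε

  n≰∣level∣ : ∀ t → ¬ n ≤ ∣ level (suc t) ∣
  n≰∣level∣ t n≤∣L∣ = absurd (chain-zero-difference 𝒢 fin lab D D↓)
    where
    chain = ⊂-chain n (level (suc t)) n≤∣L∣
    C  = proj₁ chain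
    C⊆ = proj₁ (proj₂ chain)
    C⊂ = proj₂ (proj₂ chain)
    D : Fin (suc n) → Subset m
    D i = descendants (suc t) (C i)
    D↓ : ∀ {i j} → i Fin.< j → D j ⊆ D i
    D↓ i<j = descendants-mono (proj₁ (C⊂ i<j))
    absurd : ¬ ∃₂ λ i j → i Fin.< j × labelSum 𝒢 lab (D i ─ D j) ≈ ε
    absurd (i , j , i<j , D≈ε)
      with x , x∈Ci , x∉Cj ← proj₂ (C⊂ i<j)
      with x∈A , dx≡ ← ∈-level⁻ (C⊆ i x∈Ci) =
      proper-parentClosed-≉ε (p─q⊆p A (D i ─ D j)) x∈A (λ x∈B → x∈p─q⇒x∉q A _ x∈B x∈D) root∈B
        (─-parentClosed ⊆-refl A-upwardClosed descendants-─-downwardClosed)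
        (labelSum-─≈ε 𝒢 lab (descendants⊆A ∘ p─q⊆p (D i) (D j)) (trans D≈ε (sym zeroSum)))
      where
      x∈D : x ∈ D i ─ D j
      x∈D = x∈p∧x∉q⇒x∈p─q (subst (λ d → x ∈ descendants d (C i)) dx≡ (self∈descendants x∈A x∈Ci))
              (x∉Cj ∘ self∈descendants⁻ ∘ subst (λ d → x ∈ descendants d (C j)) (≡.sym dx≡))
      root∈B : root ∈ A ─ (D i ─ D j)
      root∈B = x∈p∧x∉q⇒x∈p─q root∈A (root∉descendants ∘ p─q⊆p (D i) (D j))

module _ {c ℓ} (𝒢 : AbelianGroup c ℓ) {k} (fin : IsFiniteOfOrder 𝒢 (suc k))
         {m} (G : SimpleGraph m) (lab : Fin m → AbelianGroup.Carrier 𝒢) where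
  open AbelianGroup 𝒢 using (_≈_; ε)

  -- RadiusAtMost stands in for Connected because it is decidable.
  SmallZeroSum : Subset m → Set ℓ
  SmallZeroSum A = NonEmpty A × RadiusAtMost G k A × ∣ A ∣ ≤ suc (k * k) × labelSum 𝒢 lab A ≈ ε

  smallZeroSum? : Decidable SmallZeroSum
  smallZeroSum? A =
    nonempty? A ×-dec radiusAtMost? G k A ×-dec ∣ A ∣ ≤? suc (k * k) ×-dec
      ≈-dec fin (labelSum 𝒢 lab A) ε

  minimal⇒small : ∀ {A} → NonEmpty A → Connected G A → labelSum 𝒢 lab A ≈ ε →
    (∀ B → B ⊂ A → NonEmpty B → Connected G B → ¬ labelSum 𝒢 lab B ≈ ε) → SmallZeroSum A
  minimal⇒small {A} (r , r∈A) connected A≈ε minimal =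
    (r , r∈A) , radiusAtMost depth≤k , ∣A∣≤ depth≤k ∣level∣≤k , A≈ε
    where
    T = BreadthFirst.tree G r∈A connected
    open RootedTree T
    open Layers T
    open MinimalZeroSum 𝒢 fin lab T A≈ε minimal
    depth≤k : ∀ {y} → y ∈ A → depth y ≤ k
    depth≤k y∈A = s≤s⁻¹ (≰⇒> (n≰depth y∈A))
    ∣level∣≤k : ∀ t → ∣ level (suc t) ∣ ≤ k
    ∣level∣≤k t = s≤s⁻¹ (≰⇒> (n≰∣level∣ t))

  noSmall⇒zeroAvoiding : ¬ ∃ SmallZeroSum → ZeroAvoiding 𝒢 G lab
  noSmall⇒zeroAvoiding ∄small A = avoid A (⊂-wellFounded A)
    where
    avoid : ∀ A → Acc _⊂_ A → NonEmpty A → Connected G A → ¬ labelSum 𝒢 lab A ≈ ε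
    avoid A (acc smaller) ne connected A≈ε =
      ∄small (A , minimal⇒small ne connected A≈ε λ B B⊂A → avoid B (smaller B⊂A))

  smallZeroSum : ¬ ZeroAvoiding 𝒢 G lab → ∃ λ A →
    NonEmpty A × Connected G A × ∣ A ∣ ≤ suc (k * k) × labelSum 𝒢 lab A ≈ ε
  smallZeroSum ¬avoiding with anySubset? smallZeroSum?
  ... | yes (A , ne , radius , size , A≈ε) = A , ne , radius⇒connected radius , size , A≈ε
  ... | no ∄small = contradiction (noSmall⇒zeroAvoiding ∄small) ¬avoiding

1+n²≤[1+n]^2 : ∀ n → suc (n * n) ≤ suc n ^ 2
1+n²≤[1+n]^2 n = begin
  suc (n * n)   ≤⟨ s≤s (≤-trans (*-monoʳ-≤ n (n≤1+n n)) (m≤n+m (n * suc n) n)) ⟩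
  suc n * suc n ≡⟨ cong (suc n *_) (*-identityʳ (suc n)) ⟨
  suc n ^ 2     ∎
  where open ≤-Reasoning

lemma5p4 : ∀ {c ℓ} (𝒢 : AbelianGroup c ℓ) (n : ℕ) → IsFiniteOfOrder 𝒢 n →
    ∃ λ (s : ℕ) → s ≤ n ^ 2 ×
      (∀ (m : ℕ) (G : SimpleGraph m) (lab : Fin m → AbelianGroup.Carrier 𝒢) →
        ¬ ZeroAvoiding 𝒢 G lab →
        ∃ λ (A : Subset m) → NonEmpty A × Connected G A × ∣ A ∣ ≤ s ×
          AbelianGroup._≈_ 𝒢 (labelSum 𝒢 lab A) (AbelianGroup.ε 𝒢))
lemma5p4 𝒢 zero    fin with () ← Bijection.to⁻ fin (AbelianGroup.ε 𝒢)
lemma5p4 𝒢 (suc k) fin = suc (k * k) , 1+n²≤[1+n]^2 k , λ m G lab → smallZeroSum 𝒢 fin G lab
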